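{- Let $m\ge1,n\ge0$, and let $(R,T)\in\mathfrak{A\!C}_{m,n}^{\bullet}(k_1,k_2,l)$. Then the fiber of $(R,T)$ under $\eta$ has cardinality \[ \bigl\lvert\eta^{ -1}(R,T)\bigr\rvert=k_1(l+1)-\binom{l+1}{2}. \]
   Context: For posets $(P,\le_P)$, $(Q,\le_Q)$ on disjoint ground sets and $R\subseteq P\times Q$, $T\subseteq Q\times P$, define $\le_{R,T}$ on $P\cup Q$ by: $x\le_{R,T}y$ iff $x\le_P y$, or $x\le_Q y$, or $(x,y)\in R$, or $(x,y)\in T$. $(R,T)$ is a merging if $\le_{R,T}$ is reflexive and transitive, and a proper merging if moreover $R\cap T^{ -1}=\emptyset$. The $m$-star is the poset on $S=\{s_0,s_1,\dots,s_m\}$ with $s\le s'$ iff $s=s'$ or $s=s_0$; the $m$-antichain is the poset on $A=\{a_1,\dots,a_m\}$ with only trivial relations, and we identify $a_i=s_i$ so $A=S\setminus\{s_0\}$; the $n$-chain is the poset on $C=\{c_1,\dots,c_n\}$ with $c_i\le c_j$ iff $i\le j$. $\mathfrak{S\!C}_{m,n}^{\bullet}$ (resp. $\mathfrak{A\!C}_{m,n}^{\bullet}$) is the set of proper mergings of the $m$-star (resp. $m$-antichain) and the $n$-chain. The map $\eta:\mathfrak{S\!C}_{m,n}^{\bullet}\to\mathfrak{A\!C}_{m,n}^{\bullet}$ is $\eta(R,T)=(R\cap(A\times C),T\cap(C\times A))$. For $(R,T)\in\mathfrak{A\!C}_{m,n}^{\bullet}$: $k_1$ is the minimal index $k$ with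 $(a_j,c_k)\in R$ for some $j$ ($k_1=n+1$ if $R=\emptyset$); $k_2$ is the maximal index $k$ with $(c_k,a_j)\in T$ for some $j$ ($k_2=0$ if $T=\emptyset$); and $l\in\{0,1,\dots,k_2\}$ is the maximal index such that $(c_l,a_j)\in T$ for all $j\in\{1,\dots,m\}$ ($l=0$ if no such index exists). $\mathfrak{A\!C}_{m,n}^{\bullet}(k_1,k_2,l)$ denotes the set of $(R,T)\in\mathfrak{A\!C}_{m,n}^{\bullet}$ with these parameters. -}

module Defs where

open import Data.Bool using (Bool; true; false; _∨_)
open import Data.Nat using (ℕ; zero; suc; _≤_; _+_; _*_; _∸_)
open import Data.Fin using (Fin; toℕ)
import Data.Fin as F
open import Data.Sum using (_⊎_; inj₁; inj₂)
open import Data.Product using (Σ; _×_; _,_; ∃; ∃-syntax)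
open import Data.Vec using (Vec; lookup; tail; map)
open import Data.List using (List; length)
open import Data.List.Relation.Unary.Unique.Propositional using (Unique)
open import Data.List.Membership.Propositional using (_∈_)
open import Data.Empty using (⊥)
open import Function.Bundles using (_⇔_)
open import Relation.Nullary.Decidable using (isYes)
open import Relation.Binary.PropositionalEquality using (_≡_)

-- Finite posets on Fin p, given by a Boolean order relation.
-- Relations between finite sets are Boolean matrices (Vec of rows).

Rel₂ : ℕ → ℕ → Set
Rel₂ p q = Vec (Vec Bool q) p

_∋⟨_,_⟩ : ∀ {p q} → Rel₂ p q → Fin p → Fin q → Set
M ∋⟨ x , y ⟩ = lookup (lookup M x) y ≡ true

mergeLe : ∀ {p q} (leP : Fin p → Fin p → Bool) (leQ : Fin q → Fin q → Bool)
          (R : Rel₂ p q) (T : Rel₂ q p) → Fin p ⊎ Fin q → Fin p ⊎ Fin q → Set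
mergeLe leP leQ R T (inj₁ x) (inj₁ y) = leP x y ≡ true
mergeLe leP leQ R T (inj₂ x) (inj₂ y) = leQ x y ≡ true
mergeLe leP leQ R T (inj₁ x) (inj₂ y) = R ∋⟨ x , y ⟩
mergeLe leP leQ R T (inj₂ x) (inj₁ y) = T ∋⟨ x , y ⟩

IsMerging : ∀ {p q} (leP : Fin p → Fin p → Bool) (leQ : Fin q → Fin q → Bool)
            (R : Rel₂ p q) (T : Rel₂ q p) → Set
IsMerging leP leQ R T =
  (∀ x → mergeLe leP leQ R T x x) ×
  (∀ x y z → mergeLe leP leQ R T x y → mergeLe leP leQ R T y z →
             mergeLe leP leQ R T x z)

IsProperMerging : ∀ {p q} (leP : Fin p → Fin p → Bool) (leQ : Fin q → Fin q → Bool)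
                  (R : Rel₂ p q) (T : Rel₂ q p) → Set
IsProperMerging leP leQ R T =
  IsMerging leP leQ R T × (∀ x y → R ∋⟨ x , y ⟩ → T ∋⟨ y , x ⟩ → ⊥)

-- The m-star on Fin (suc m): index zero is s₀, index (suc j) is s_{j+1}.
starLe : ∀ {m} → Fin (suc m) → Fin (suc m) → Bool
starLe x y = isYes (x F.≟ y) ∨ isYes (x F.≟ F.zero)

-- The m-antichain on Fin m: index j is a_{j+1} (identified with s_{j+1}).
antichainLe : ∀ {m} → Fin m → Fin m → Bool
antichainLe x y = isYes (x F.≟ y)

-- The n-chain on Fin n: index i is c_{i+1}.
chainLe : ∀ {n} → Fin n → Fin n → Bool
chainLe x y = isYes (x F.≤? y)

SC : ℕ → ℕ → Set
SC m n = Rel₂ (suc m) n × Rel₂ n (suc m)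

AC : ℕ → ℕ → Set
AC m n = Rel₂ m n × Rel₂ n m

IsSC : ∀ {m n} → SC m n → Set
IsSC (R , T) = IsProperMerging starLe chainLe R T

IsAC : ∀ {m n} → AC m n → Set
IsAC (R , T) = IsProperMerging antichainLe chainLe R T

-- η(R,T) = (R ∩ (A × C), T ∩ (C × A)): drop the row/column of s₀.
η : ∀ {m n} → SC m n → AC m n
η (R , T) = tail R , map tail T

-- The parameters k₁, k₂, l (chain positions are 1-based: c_{i+1} ↦ suc (toℕ i)).

IsK1 : ∀ {m n} → Rel₂ m n → ℕ → Set
IsK1 {m} {n} R k₁ =
  (∀ j i → R ∋⟨ j , i ⟩ → k₁ ≤ suc (toℕ i)) ×
  (k₁ ≡ suc n ⊎ (∃[ j ] ∃[ i ] (R ∋⟨ j , i ⟩ × k₁ ≡ suc (toℕ i))))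

IsK2 : ∀ {m n} → Rel₂ n m → ℕ → Set
IsK2 T k₂ =
  (∀ i j → T ∋⟨ i , j ⟩ → suc (toℕ i) ≤ k₂) ×
  (k₂ ≡ 0 ⊎ (∃[ i ] ∃[ j ] (T ∋⟨ i , j ⟩ × k₂ ≡ suc (toℕ i))))

IsL : ∀ {m n} → Rel₂ n m → ℕ → ℕ → Set
IsL T k₂ l =
  l ≤ k₂ ×
  (∀ i → suc (toℕ i) ≤ k₂ → (∀ j → T ∋⟨ i , j ⟩) → suc (toℕ i) ≤ l) ×
  (l ≡ 0 ⊎ (∃[ i ] (l ≡ suc (toℕ i) × (∀ j → T ∋⟨ i , j ⟩))))

HasCard : {A : Set} → (A → Set) → ℕ → Set
HasCard {A} P N =
  Σ (List A) λ xs → Unique xs × (∀ x → (x ∈ xs) ⇔ P x) × length xs ≡ N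

InFiber : ∀ {m n} → AC m n → SC m n → Set
InFiber RT x = IsSC x × η x ≡ RT

module Submission where

-- An element of the fiber η⁻¹(R,T) is (R,T) with one new row u
-- (the relations s₀ ≤ cᵢ) and one new column v (the relations cᵢ ≤ s₀); all
-- relations s₀ ≤ aⱼ are forced by the star.  So the fiber is in bijection with
-- the pairs (u,v) for which the one-point extension of the merged poset by s₀
-- is again a proper merging.

open import Defs
open import Data.Nat using (ℕ; suc; _≤_; _*_; _∸_)
open import Data.Nat.Combinatorics using (_C_)
open import Data.Product using (_,_)

open import Data.Nat using (zero; _+_; _<_; z≤n; s≤s; s≤s⁻¹; _≤?_; _<?_)
open import Data.Nat.Properties
open import Data.Nat.Combinatorics using (nCk+nC[k+1]≡[n+1]C[k+1]; nC1≡n)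
open import Algebra.Properties.CommutativeSemigroup +-commutativeSemigroup using (interchange)
open import Data.Bool using (Bool; true; false)
open import Data.Unit using (⊤; tt)
open import Data.Empty using (⊥; ⊥-elim)
open import Data.Fin as F using (Fin; toℕ; fromℕ<)
import Data.Fin.Properties as FP
open import Data.Vec using (Vec; []; _∷_; lookup; tabulate; head; tail; map)
open import Data.Vec.Properties using (lookup∘tabulate; tabulate∘lookup; tabulate-cong)
open import Data.List as L using (List; _++_; applyUpTo)
open import Data.List.Properties using (length-map; length-++; length-applyUpTo)
open import Data.List.Relation.Unary.All as All using ()
open import Data.List.Relation.Unary.All.Properties as AllP using ()
open import Data.List.Relation.Unary.AllPairs using ([]; _∷_)
open import Data.List.Relation.Unary.Any using (here; there)
open import Data.List.Relation.Unary.Unique.Propositional using (Unique)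
import Data.List.Relation.Unary.Unique.Propositional.Properties as Unique
open import Data.List.Membership.Propositional using (_∈_)
open import Data.List.Membership.Propositional.Properties
  using (∈-map⁺; ∈-map⁻; ∈-++⁺ˡ; ∈-++⁺ʳ; ∈-++⁻; ∈-applyUpTo⁺; ∈-applyUpTo⁻)
open import Data.Product using (_×_; ∃-syntax; proj₁; proj₂)
open import Data.Sum using (_⊎_; inj₁; inj₂)
open import Relation.Nullary using (Dec; yes; no; ¬_)
open import Relation.Nullary.Decidable using (isYes)
open import Relation.Binary.PropositionalEquality
open import Function using (case_of_)
open import Function.Bundles using (_⇔_; mk⇔; Equivalence)
open import Function.Properties.Equivalence using () renaming (refl to ⇔-refl; trans to ⇔-trans; sym to ⇔-sym)

open Equivalence using (to; from)

hasCard-⇔ : {A : Set} {P Q : A → Set} {M N : ℕ} →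
  (∀ x → P x ⇔ Q x) → M ≡ N → HasCard P M → HasCard Q N
hasCard-⇔ P⇔Q refl (xs , unique , mem , len) =
  xs , unique , (λ x → ⇔-trans (mem x) (P⇔Q x)) , len

hasCard-∅ : {A : Set} {P : A → Set} → (∀ x → ¬ P x) → HasCard P 0
hasCard-∅ ¬P = L.[] , [] , (λ x → mk⇔ (λ ()) (λ p → ⊥-elim (¬P x p))) , refl

hasCard-⊎ : {A : Set} {P Q : A → Set} {a b : ℕ} → (∀ x → P x → Q x → ⊥) →
  HasCard P a → HasCard Q b → HasCard (λ x → P x ⊎ Q x) (a + b)
hasCard-⊎ {P = P} {Q} disjoint (xs , uxs , memP , lenP) (ys , uys , memQ , lenQ) =
  xs ++ ys ,
  Unique.++⁺ uxs uys (λ (x∈xs , x∈ys) → disjoint _ (to (memP _) x∈xs) (to (memQ _) x∈ys)) ,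
  (λ x → mk⇔ (member x) (nonmember x)) ,
  trans (length-++ xs) (cong₂ _+_ lenP lenQ)
  where
  member : ∀ x → x ∈ xs ++ ys → P x ⊎ Q x
  member x x∈ with ∈-++⁻ xs x∈
  ... | inj₁ x∈xs = inj₁ (to (memP x) x∈xs)
  ... | inj₂ x∈ys = inj₂ (to (memQ x) x∈ys)
  nonmember : ∀ x → P x ⊎ Q x → x ∈ xs ++ ys
  nonmember x (inj₁ p) = ∈-++⁺ˡ (from (memP x) p)
  nonmember x (inj₂ q) = ∈-++⁺ʳ xs (from (memQ x) q)

map-unique : {A B : Set} (f : A → B) {xs : List A} →
  (∀ {x y} → x ∈ xs → y ∈ xs → f x ≡ f y → x ≡ y) →
  Unique xs → Unique (L.map f xs)
map-unique f inj [] = []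
map-unique f inj (x∉xs ∷ uxs) =
  AllP.map⁺ (All.tabulate λ y∈xs fx≡fy →
    All.lookup x∉xs y∈xs (inj (here refl) (there y∈xs) fx≡fy)) ∷
  map-unique f (λ x∈ y∈ → inj (there x∈) (there y∈)) uxs

hasCard-image : {A B : Set} {P : A → Set} {N : ℕ} (f : A → B) →
  (∀ {x y} → P x → P y → f x ≡ f y → x ≡ y) →
  HasCard P N → HasCard (λ y → ∃[ x ] (P x × f x ≡ y)) N
hasCard-image {P = P} f inj (xs , uxs , mem , len) =
  L.map f xs ,
  map-unique f (λ x∈ y∈ → inj (to (mem _) x∈) (to (mem _) y∈)) uxs ,
  (λ y → mk⇔ (member y) (nonmember y)) ,
  trans (length-map f xs) len
  where
  member : ∀ y → y ∈ L.map f xs → ∃[ x ] (P x × f x ≡ y)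
  member y y∈ with ∈-map⁻ f y∈
  ... | x , x∈xs , refl = x , to (mem x) x∈xs , refl
  nonmember : ∀ y → ∃[ x ] (P x × f x ≡ y) → y ∈ L.map f xs
  nonmember y (x , p , refl) = ∈-map⁺ f (from (mem x) p)

Staircase : ℕ → ℕ → ℕ × ℕ → Set
Staircase k L (t , r) = t < L × t < r × r ≤ k

StairRow : ℕ → ℕ → ℕ × ℕ → Set
StairRow k t (t′ , r) = t′ ≡ t × t < r × r ≤ k

-- Row t of the staircase has k ∸ t elements: it is listed by r = t + 1 + d, d < k ∸ t.
hasCard-row : ∀ k t → HasCard (StairRow k t) (k ∸ t)
hasCard-row k t =
  applyUpTo entry (k ∸ t) ,
  Unique.applyUpTo⁺₁ entry (k ∸ t)
    (λ d<d′ _ eq → <⇒≢ d<d′ (+-cancelˡ-≡ (suc t) _ _ (cong proj₂ eq))) ,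
  (λ p → mk⇔ (member p) (nonmember p)) ,
  length-applyUpTo entry (k ∸ t)
  where
  entry : ℕ → ℕ × ℕ
  entry d = t , suc t + d

  member : ∀ p → p ∈ applyUpTo entry (k ∸ t) → StairRow k t p
  member p p∈ with ∈-applyUpTo⁻ entry p∈
  ... | d , d<k∸t , refl = refl , s≤s (m≤m+n t d) , (begin
      suc t + d ≡⟨ cong suc (+-comm t d) ⟩
      suc d + t ≤⟨ m≤o∸n⇒m+n≤o (suc d) t≤k d<k∸t ⟩
      k         ∎)
    where
    open ≤-Reasoning
    t≤k : t ≤ k
    t≤k = <⇒≤ (m∸n≢0⇒n<m (m<n⇒n≢0 d<k∸t))

  nonmember : ∀ p → StairRow k t p → p ∈ applyUpTo entry (k ∸ t)
  nonmember (.t , r) (refl , t<r , r≤k) =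
    subst (λ x → (t , x) ∈ applyUpTo entry (k ∸ t)) (m+[n∸m]≡n t<r)
      (∈-applyUpTo⁺ entry (m+n≤o⇒m≤o∸n (suc d) (begin
        suc d + t ≡⟨ cong suc (+-comm d t) ⟩
        suc t + d ≡⟨ m+[n∸m]≡n t<r ⟩
        r         ≤⟨ r≤k ⟩
        k         ∎)))
    where
    open ≤-Reasoning
    d : ℕ
    d = r ∸ suc t

stairSize : ℕ → ℕ → ℕ
stairSize k zero = 0
stairSize k (suc L) = stairSize k L + (k ∸ L)

hasCard-staircase : ∀ k L → HasCard (Staircase k L) (stairSize k L)
hasCard-staircase k zero = hasCard-∅ λ { (t , r) (() , _) }
hasCard-staircase k (suc L) =
  hasCard-⇔ split refl
    (hasCard-⊎ disjoint (hasCard-staircase k L) (hasCard-row k L))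
  where
  disjoint : ∀ p → Staircase k L p → StairRow k L p → ⊥
  disjoint _ (t<L , _) (refl , _) = <-irrefl refl t<L

  split : ∀ p → (Staircase k L p ⊎ StairRow k L p) ⇔ Staircase k (suc L) p
  split (t , r) = mk⇔ join divide
    where
    join : Staircase k L (t , r) ⊎ StairRow k L (t , r) → Staircase k (suc L) (t , r)
    join (inj₁ (t<L , rest)) = m<n⇒m<1+n t<L , rest
    join (inj₂ (refl , rest)) = ≤-refl , rest
    divide : Staircase k (suc L) (t , r) → Staircase k L (t , r) ⊎ StairRow k L (t , r)
    divide (s≤s t≤L , rest) with m≤n⇒m<n∨m≡n t≤L
    ... | inj₁ t<L = inj₁ (t<L , rest)
    ... | inj₂ refl = inj₂ (refl , rest)

stairSize-closed : ∀ k L → L ≤ k → stairSize k L + L C 2 ≡ k * L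
stairSize-closed k zero _ = sym (*-zeroʳ k)
stairSize-closed k (suc L) 1+L≤k = begin
  (stairSize k L + (k ∸ L)) + suc L C 2
    ≡⟨ cong ((stairSize k L + (k ∸ L)) +_) (sym pascal) ⟩
  (stairSize k L + (k ∸ L)) + (L C 2 + L)
    ≡⟨ interchange (stairSize k L) (k ∸ L) (L C 2) L ⟩
  (stairSize k L + L C 2) + ((k ∸ L) + L)
    ≡⟨ cong₂ _+_ (stairSize-closed k L L≤k) (m∸n+n≡m L≤k) ⟩
  k * L + k
    ≡⟨ trans (+-comm (k * L) k) (sym (*-suc k L)) ⟩
  k * suc L ∎
  where
  open ≡-Reasoning
  L≤k : L ≤ k
  L≤k = <⇒≤ 1+L≤k
  pascal : L C 2 + L ≡ suc L C 2
  pascal = trans (+-comm (L C 2) L)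
    (trans (cong (_+ L C 2) (sym (nC1≡n L))) (nCk+nC[k+1]≡[n+1]C[k+1] L 1))

isYes⇔ : ∀ {A : Set} (d : Dec A) → isYes d ≡ true ⇔ A
isYes⇔ (yes a) = mk⇔ (λ _ → a) (λ _ → refl)
isYes⇔ (no ¬a) = mk⇔ (λ ()) (λ a → ⊥-elim (¬a a))

boolVec-ext : ∀ {n} {u w : Vec Bool n} →
  (∀ i → lookup u i ≡ true ⇔ lookup w i ≡ true) → u ≡ w
boolVec-ext {u = u} {w} same = begin
  u                  ≡⟨ sym (tabulate∘lookup u) ⟩
  tabulate (lookup u) ≡⟨ tabulate-cong (λ i → bool-ext (same i)) ⟩
  tabulate (lookup w) ≡⟨ tabulate∘lookup w ⟩
  w                  ∎
  where
  open ≡-Reasoning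
  bool-ext : ∀ {b c : Bool} → (b ≡ true ⇔ c ≡ true) → b ≡ c
  bool-ext {true} b⇔c = sym (to b⇔c refl)
  bool-ext {false} {true} b⇔c = from b⇔c refl
  bool-ext {false} {false} b⇔c = refl

-- Positions are numbered 1,…,n as in the chain c₁ < ⋯ < cₙ.
-- `up r` is true exactly at the positions ≥ r, `down t` exactly at those ≤ t.
up : ∀ {n} → ℕ → Vec Bool n
up r = tabulate λ i → isYes (r ≤? suc (toℕ i))

down : ∀ {n} → ℕ → Vec Bool n
down t = tabulate λ i → isYes (suc (toℕ i) ≤? t)

up-spec : ∀ {n} r (i : Fin n) → lookup (up r) i ≡ true ⇔ r ≤ suc (toℕ i)
up-spec r i rewrite lookup∘tabulate (λ i → isYes (r ≤? suc (toℕ i))) i =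
  isYes⇔ (r ≤? suc (toℕ i))

down-spec : ∀ {n} t (i : Fin n) → lookup (down t) i ≡ true ⇔ suc (toℕ i) ≤ t
down-spec t i rewrite lookup∘tabulate (λ i → isYes (suc (toℕ i) ≤? t)) i =
  isYes⇔ (suc (toℕ i) ≤? t)

UpClosed DownClosed : ∀ {n} → Vec Bool n → Set
UpClosed u = ∀ i i′ → toℕ i ≤ toℕ i′ → lookup u i ≡ true → lookup u i′ ≡ true
DownClosed v = ∀ i i′ → toℕ i ≤ toℕ i′ → lookup v i′ ≡ true → lookup v i ≡ true

upClosed-threshold : ∀ {n} (u : Vec Bool n) → UpClosed u →
  ∃[ r ] (1 ≤ r × r ≤ suc n × (∀ i → lookup u i ≡ true ⇔ r ≤ suc (toℕ i)))
upClosed-threshold [] _ = 1 , ≤-refl , s≤s z≤n , λ ()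
upClosed-threshold (true ∷ u) closed =
  1 , ≤-refl , s≤s z≤n , λ i → mk⇔ (λ _ → s≤s z≤n) (λ _ → closed F.zero i z≤n refl)
upClosed-threshold (false ∷ u) closed
  with r , 1≤r , r≤1+n , spec ← upClosed-threshold u (λ i i′ le → closed (F.suc i) (F.suc i′) (s≤s le)) =
  suc r , s≤s z≤n , s≤s r≤1+n , shifted
  where
  shifted : ∀ i → lookup (false ∷ u) i ≡ true ⇔ suc r ≤ suc (toℕ i)
  shifted F.zero = mk⇔ (λ ()) (λ { (s≤s r≤0) → ⊥-elim (<-irrefl refl (≤-trans 1≤r r≤0)) })
  shifted (F.suc i) = ⇔-trans (spec i) (mk⇔ s≤s s≤s⁻¹)

downClosed-threshold : ∀ {n} (v : Vec Bool n) → DownClosed v →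
  ∃[ t ] (t ≤ n × (∀ i → lookup v i ≡ true ⇔ suc (toℕ i) ≤ t))
downClosed-threshold [] _ = 0 , z≤n , λ ()
downClosed-threshold (false ∷ v) closed =
  0 , z≤n , λ i → mk⇔ (λ vᵢ → case closed F.zero i z≤n vᵢ of λ ()) (λ ())
downClosed-threshold (true ∷ v) closed
  with t , t≤n , spec ← downClosed-threshold v (λ i i′ le → closed (F.suc i) (F.suc i′) (s≤s le)) =
  suc t , s≤s t≤n , shifted
  where
  shifted : ∀ i → lookup (true ∷ v) i ≡ true ⇔ suc (toℕ i) ≤ suc t
  shifted F.zero = mk⇔ (λ _ → s≤s z≤n) (λ _ → refl)
  shifted (F.suc i) = ⇔-trans (spec i) (mk⇔ s≤s s≤s⁻¹)

upClosed⇒up : ∀ {n} (u : Vec Bool n) → UpClosed u → ∃[ r ] (1 ≤ r × r ≤ suc n × u ≡ up r)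
upClosed⇒up u closed with r , 1≤r , r≤1+n , spec ← upClosed-threshold u closed =
  r , 1≤r , r≤1+n , boolVec-ext λ i → ⇔-trans (spec i) (⇔-sym (up-spec r i))

downClosed⇒down : ∀ {n} (v : Vec Bool n) → DownClosed v → ∃[ t ] (t ≤ n × v ≡ down t)
downClosed⇒down v closed with t , t≤n , spec ← downClosed-threshold v closed =
  t , t≤n , boolVec-ext λ i → ⇔-trans (spec i) (⇔-sym (down-spec t i))

position : ∀ {n k} → k < n → ∃[ i ] (toℕ {n} i ≡ k)
position k<n = fromℕ< k<n , FP.toℕ-fromℕ< k<n

upBound : ∀ {n r r′} → 1 ≤ r → r′ ≤ suc n →
  (∀ (i : Fin n) → r ≤ suc (toℕ i) → r′ ≤ suc (toℕ i)) → r′ ≤ r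
upBound {n} {suc k} _ r′≤1+n admits with k <? n
... | yes k<n with i , refl ← position k<n = admits i ≤-refl
... | no k≮n = ≤-trans r′≤1+n (s≤s (≮⇒≥ k≮n))

downBound : ∀ {n t t′} → t ≤ n →
  (∀ (i : Fin n) → suc (toℕ i) ≤ t → suc (toℕ i) ≤ t′) → t ≤ t′
downBound {t = zero} _ _ = z≤n
downBound {t = suc k} k<n admits with i , refl ← position k<n = admits i ≤-refl

up-injective : ∀ {n r r′} → 1 ≤ r → r ≤ suc n → 1 ≤ r′ → r′ ≤ suc n →
  up {n} r ≡ up r′ → r ≡ r′
up-injective 1≤r r≤1+n 1≤r′ r′≤1+n eq =
  ≤-antisym (upBound 1≤r′ r≤1+n (admits (sym eq))) (upBound 1≤r r′≤1+n (admits eq))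
  where
  admits : ∀ {a b} → up a ≡ up b → ∀ i → a ≤ suc (toℕ i) → b ≤ suc (toℕ i)
  admits {a} {b} same i a≤ = to (up-spec b i) (subst (λ w → lookup w i ≡ true) same (from (up-spec a i) a≤))

down-injective : ∀ {n t t′} → t ≤ n → t′ ≤ n → down {n} t ≡ down t′ → t ≡ t′
down-injective t≤n t′≤n eq =
  ≤-antisym (downBound t≤n (admits eq)) (downBound t′≤n (admits (sym eq)))
  where
  admits : ∀ {a b} → down a ≡ down b → ∀ i → suc (toℕ i) ≤ a → suc (toℕ i) ≤ b
  admits {a} {b} same i ≤a = to (down-spec b i) (subst (λ w → lookup w i ≡ true) same (from (down-spec a i) ≤a))

addColumn : ∀ {n m} → Vec Bool n → Rel₂ n m → Rel₂ n (suc m)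
addColumn [] [] = []
addColumn (b ∷ v) (row ∷ T) = (b ∷ row) ∷ addColumn v T

addColumn-new : ∀ {n m} (v : Vec Bool n) (T : Rel₂ n m) i →
  lookup (lookup (addColumn v T) i) F.zero ≡ lookup v i
addColumn-new (b ∷ v) (row ∷ T) F.zero = refl
addColumn-new (b ∷ v) (row ∷ T) (F.suc i) = addColumn-new v T i

addColumn-old : ∀ {n m} (v : Vec Bool n) (T : Rel₂ n m) i j →
  lookup (lookup (addColumn v T) i) (F.suc j) ≡ lookup (lookup T i) j
addColumn-old (b ∷ v) (row ∷ T) F.zero j = refl
addColumn-old (b ∷ v) (row ∷ T) (F.suc i) j = addColumn-old v T i j

tail-addColumn : ∀ {n m} (v : Vec Bool n) (T : Rel₂ n m) → map tail (addColumn v T) ≡ T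
tail-addColumn [] [] = refl
tail-addColumn (b ∷ v) (row ∷ T) = cong (row ∷_) (tail-addColumn v T)

head-addColumn : ∀ {n m} (v : Vec Bool n) (T : Rel₂ n m) → map head (addColumn v T) ≡ v
head-addColumn [] [] = refl
head-addColumn (b ∷ v) (row ∷ T) = cong (b ∷_) (head-addColumn v T)

addColumn-η : ∀ {n m} (T′ : Rel₂ n (suc m)) → addColumn (map head T′) (map tail T′) ≡ T′
addColumn-η [] = refl
addColumn-η ((b ∷ row) ∷ T′) = cong ((b ∷ row) ∷_) (addColumn-η T′)

lift : ∀ {m n} → Fin m ⊎ Fin n → Fin (suc m) ⊎ Fin n
lift (inj₁ j) = inj₁ (F.suc j)
lift (inj₂ i) = inj₂ i

s₀ : ∀ {m n} → Fin (suc m) ⊎ Fin n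
s₀ = inj₁ F.zero

data Point {m n : ℕ} : Fin (suc m) ⊎ Fin n → Set where
  new : Point s₀
  old : (x : Fin m ⊎ Fin n) → Point (lift x)

point : ∀ {m n} (y : Fin (suc m) ⊎ Fin n) → Point y
point (inj₁ F.zero) = new
point (inj₁ (F.suc j)) = old (inj₁ j)
point (inj₂ i) = old (inj₂ i)

starLe-suc : ∀ {m} (j j′ : Fin m) → starLe (F.suc j) (F.suc j′) ≡ antichainLe j j′
starLe-suc j j′ with j F.≟ j′
... | yes _ = refl
... | no _ = refl

chainLe-⇔ : ∀ {n} (i i′ : Fin n) → chainLe i i′ ≡ true ⇔ toℕ i ≤ toℕ i′
chainLe-⇔ i i′ = isYes⇔ (i F.≤? i′)

-- The extension of an antichain–chain relation pair (R,T) by the new row u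
-- (the relations s₀ ≤ cᵢ) and the new column v (the relations cᵢ ≤ s₀).
module Extension {m n} (R : Rel₂ m n) (T : Rel₂ n m) (u v : Vec Bool n) where

  extended : SC m n
  extended = u ∷ R , addColumn v T

  _≤ₐ_ : Fin m ⊎ Fin n → Fin m ⊎ Fin n → Set
  _≤ₐ_ = mergeLe antichainLe chainLe R T

  _⊑_ : Fin (suc m) ⊎ Fin n → Fin (suc m) ⊎ Fin n → Set
  _⊑_ = mergeLe starLe chainLe (u ∷ R) (addColumn v T)

  Above : Fin m ⊎ Fin n → Set
  Above (inj₁ _) = ⊤
  Above (inj₂ i) = lookup u i ≡ true

  Below : Fin m ⊎ Fin n → Set
  Below (inj₁ _) = ⊥
  Below (inj₂ i) = lookup v i ≡ true

  lift-⇔ : ∀ x y → lift x ⊑ lift y ⇔ x ≤ₐ y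
  lift-⇔ (inj₁ j) (inj₁ j′) = mk⇔ (trans (sym (starLe-suc j j′))) (trans (starLe-suc j j′))
  lift-⇔ (inj₁ j) (inj₂ i) = ⇔-refl
  lift-⇔ (inj₂ i) (inj₁ j) = mk⇔ (trans (sym (addColumn-old v T i j))) (trans (addColumn-old v T i j))
  lift-⇔ (inj₂ i) (inj₂ i′) = ⇔-refl

  above-⇔ : ∀ x → s₀ ⊑ lift x ⇔ Above x
  above-⇔ (inj₁ j) = mk⇔ (λ _ → tt) (λ _ → refl)
  above-⇔ (inj₂ i) = ⇔-refl

  below-⇔ : ∀ x → lift x ⊑ s₀ ⇔ Below x
  below-⇔ (inj₁ j) = mk⇔ (λ ()) (λ ())
  below-⇔ (inj₂ i) = mk⇔ (trans (sym (addColumn-new v T i))) (trans (addColumn-new v T i))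

  -- The conditions under which adding s₀ keeps a proper merging.
  record Admissible : Set where
    field
      above-upward : ∀ x y → x ≤ₐ y → Above x → Above y
      below-downward : ∀ x y → x ≤ₐ y → Below y → Below x
      below≤above : ∀ x y → Below x → Above y → x ≤ₐ y
      below-above-disjoint : ∀ x → Below x → Above x → ⊥

  admissible⇒isSC : IsAC (R , T) → Admissible → IsSC extended
  admissible⇒isSC ((≤ₐ-refl , ≤ₐ-trans) , ≤ₐ-proper) adm = (⊑-refl , ⊑-trans) , ⊑-proper
    where
    open Admissible adm

    ⊑-refl : ∀ x → x ⊑ x
    ⊑-refl x with point x
    ... | new = refl
    ... | old x = from (lift-⇔ x x) (≤ₐ-refl x)

    ⊑-trans : ∀ x y z → x ⊑ y → y ⊑ z → x ⊑ z
    ⊑-trans x y z with point x | point y | point z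
    ... | new | new | _ = λ _ y⊑z → y⊑z
    ... | _ | new | new = λ x⊑y _ → x⊑y
    ... | new | old y | new = λ _ _ → refl
    ... | new | old y | old z = λ s₀⊑y y⊑z →
      from (above-⇔ z) (above-upward y z (to (lift-⇔ y z) y⊑z) (to (above-⇔ y) s₀⊑y))
    ... | old x | old y | new = λ x⊑y y⊑s₀ →
      from (below-⇔ x) (below-downward x y (to (lift-⇔ x y) x⊑y) (to (below-⇔ y) y⊑s₀))
    ... | old x | new | old z = λ x⊑s₀ s₀⊑z →
      from (lift-⇔ x z) (below≤above x z (to (below-⇔ x) x⊑s₀) (to (above-⇔ z) s₀⊑z))
    ... | old x | old y | old z = λ x⊑y y⊑z →
      from (lift-⇔ x z) (≤ₐ-trans x y z (to (lift-⇔ x y) x⊑y) (to (lift-⇔ y z) y⊑z))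

    ⊑-proper : ∀ a c → (u ∷ R) ∋⟨ a , c ⟩ → addColumn v T ∋⟨ c , a ⟩ → ⊥
    ⊑-proper F.zero i s₀≤cᵢ cᵢ≤s₀ =
      below-above-disjoint (inj₂ i) (to (below-⇔ (inj₂ i)) cᵢ≤s₀) s₀≤cᵢ
    ⊑-proper (F.suc j) i aⱼ≤cᵢ cᵢ≤aⱼ =
      ≤ₐ-proper j i aⱼ≤cᵢ (to (lift-⇔ (inj₂ i) (inj₁ j)) cᵢ≤aⱼ)

  -- Necessity: each condition is an instance of transitivity through s₀,
  -- and disjointness is properness at s₀.
  isSC⇒admissible : IsSC extended → Admissible
  isSC⇒admissible ((_ , ⊑-trans) , ⊑-proper) = record
    { above-upward = λ x y x≤y x↑ → to (above-⇔ y)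
        (⊑-trans s₀ (lift x) (lift y) (from (above-⇔ x) x↑) (from (lift-⇔ x y) x≤y))
    ; below-downward = λ x y x≤y y↓ → to (below-⇔ x)
        (⊑-trans (lift x) (lift y) s₀ (from (lift-⇔ x y) x≤y) (from (below-⇔ y) y↓))
    ; below≤above = λ x y x↓ y↑ → to (lift-⇔ x y)
        (⊑-trans (lift x) s₀ (lift y) (from (below-⇔ x) x↓) (from (above-⇔ y) y↑))
    ; below-above-disjoint = disjoint
    }
    where
    disjoint : ∀ x → Below x → Above x → ⊥
    disjoint (inj₂ i) cᵢ↓ cᵢ↑ = ⊑-proper F.zero i cᵢ↑ (from (below-⇔ (inj₂ i)) cᵢ↓)

-- The fiber over a proper merging (R,T) of the m-antichain (m ≥ 1, witnessed
-- by a₀) and the n-chain, with parameters k₁, k₂, l.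
module Fiber {m n} (a₀ : Fin m) (R : Rel₂ m n) (T : Rel₂ n m) (ac : IsAC (R , T))
             {k₁ k₂ l : ℕ} (K1 : IsK1 R k₁) (K2 : IsK2 T k₂) (Lh : IsL T k₂ l) where

  open Extension R T using (extended; Admissible; module Admissible; admissible⇒isSC; isSC⇒admissible)

  _≤ₐ_ : Fin m ⊎ Fin n → Fin m ⊎ Fin n → Set
  _≤ₐ_ = mergeLe antichainLe chainLe R T

  ≤ₐ-trans : ∀ x y z → x ≤ₐ y → y ≤ₐ z → x ≤ₐ z
  ≤ₐ-trans = proj₂ (proj₁ ac)

  ≤ₐ-proper : ∀ j i → R ∋⟨ j , i ⟩ → T ∋⟨ i , j ⟩ → ⊥
  ≤ₐ-proper = proj₂ ac

  k₁≤1+n : k₁ ≤ suc n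
  k₁≤1+n with proj₂ K1
  ... | inj₁ k₁≡1+n = ≤-reflexive k₁≡1+n
  ... | inj₂ (_ , i , _ , refl) = s≤s (<⇒≤ (FP.toℕ<n i))

  columns-full : ∀ i → suc (toℕ i) ≤ l → ∀ j → T ∋⟨ i , j ⟩
  columns-full i i<l j with proj₂ (proj₂ Lh)
  ... | inj₁ refl with () ← i<l
  ... | inj₂ (i₀ , refl , full) =
    ≤ₐ-trans (inj₂ i) (inj₂ i₀) (inj₁ j) (from (chainLe-⇔ i i₀) (s≤s⁻¹ i<l)) (full j)

  -- l < k₁: otherwise some aⱼ ≤ c_{k₁} ≤ c_l ≤ aⱼ, contradicting properness.
  l<k₁ : l < k₁
  l<k₁ with proj₂ (proj₂ Lh) | proj₂ K1
  ... | inj₁ refl | inj₁ refl = s≤s z≤n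
  ... | inj₁ refl | inj₂ (_ , _ , _ , refl) = s≤s z≤n
  ... | inj₂ (i₀ , refl , _) | inj₁ refl = s≤s (FP.toℕ<n i₀)
  ... | inj₂ (i₀ , refl , full) | inj₂ (j , i , aⱼ≤cᵢ , refl) with toℕ i ≤? toℕ i₀
  ...   | yes i≤i₀ = ⊥-elim (≤ₐ-proper j i₀
          (≤ₐ-trans (inj₁ j) (inj₂ i) (inj₂ i₀) aⱼ≤cᵢ (from (chainLe-⇔ i i₀) i≤i₀)) (full j))
  ...   | no i≰i₀ = s≤s (≰⇒> i≰i₀)

  fiberElem : ℕ × ℕ → SC m n
  fiberElem (t , r) = extended (up r) (down t)

  staircase⇒admissible : ∀ {t r} → Staircase k₁ (suc l) (t , r) → Admissible (up r) (down t)
  staircase⇒admissible {t} {r} (s≤s t≤l , t<r , r≤k₁) = record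
    { above-upward = upward
    ; below-downward = downward
    ; below≤above = below≤above
    ; below-above-disjoint = disjoint
    }
    where
    open Extension R T (up r) (down t) using (Above; Below)
    upward : ∀ x y → x ≤ₐ y → Above x → Above y
    upward _ (inj₁ _) _ _ = tt
    upward (inj₁ j) (inj₂ i) aⱼ≤cᵢ _ = from (up-spec r i) (≤-trans r≤k₁ (proj₁ K1 j i aⱼ≤cᵢ))
    upward (inj₂ i) (inj₂ i′) cᵢ≤cᵢ′ cᵢ↑ =
      from (up-spec r i′) (≤-trans (to (up-spec r i) cᵢ↑) (s≤s (to (chainLe-⇔ i i′) cᵢ≤cᵢ′)))
    downward : ∀ x y → x ≤ₐ y → Below y → Below x
    downward _ (inj₁ _) _ ()
    downward (inj₁ j) (inj₂ i) aⱼ≤cᵢ cᵢ↓ = ⊥-elim (<-irrefl refl (begin-strict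
      k₁          ≤⟨ proj₁ K1 j i aⱼ≤cᵢ ⟩
      suc (toℕ i) ≤⟨ to (down-spec t i) cᵢ↓ ⟩
      t           ≤⟨ t≤l ⟩
      l           <⟨ l<k₁ ⟩
      k₁          ∎))
      where open ≤-Reasoning
    downward (inj₂ i′) (inj₂ i) cᵢ′≤cᵢ cᵢ↓ =
      from (down-spec t i′) (≤-trans (s≤s (to (chainLe-⇔ i′ i) cᵢ′≤cᵢ)) (to (down-spec t i) cᵢ↓))
    below≤above : ∀ x y → Below x → Above y → x ≤ₐ y
    below≤above (inj₂ i) (inj₁ j) cᵢ↓ _ = columns-full i (≤-trans (to (down-spec t i) cᵢ↓) t≤l) j
    below≤above (inj₂ i) (inj₂ i′) cᵢ↓ cᵢ′↑ = from (chainLe-⇔ i i′)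
      (<⇒≤ (s≤s⁻¹ (≤-trans (s≤s (to (down-spec t i) cᵢ↓)) (≤-trans t<r (to (up-spec r i′) cᵢ′↑)))))
    disjoint : ∀ x → Below x → Above x → ⊥
    disjoint (inj₂ i) cᵢ↓ cᵢ↑ =
      <-irrefl refl (≤-<-trans (to (up-spec r i) cᵢ↑) (≤-<-trans (to (down-spec t i) cᵢ↓) t<r))

  -- Necessity, in three bounds on an admissible pair (up r, down t).
  -- First, s₀ ≤ aⱼ ≤ c_{k₁} forces r ≤ k₁.
  admissible⇒r≤k₁ : ∀ {t r} → r ≤ suc n → Admissible (up r) (down t) → r ≤ k₁
  admissible⇒r≤k₁ {r = r} r≤1+n adm with proj₂ K1
  ... | inj₁ refl = r≤1+n
  ... | inj₂ (j , i , aⱼ≤cᵢ , refl) =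
    to (up-spec r i) (Admissible.above-upward adm (inj₁ j) (inj₂ i) aⱼ≤cᵢ tt)

  -- Second, c_t ≤ s₀, so c_t is not above s₀: t < r.
  admissible⇒t<r : ∀ t {r} → t ≤ n → 1 ≤ r → Admissible (up r) (down t) → t < r
  admissible⇒t<r zero _ 1≤r _ = 1≤r
  admissible⇒t<r (suc k) {r} t≤n _ adm with i , refl ← position t≤n with r ≤? suc (toℕ i)
  ... | yes r≤1+i = ⊥-elim (Admissible.below-above-disjoint adm (inj₂ i)
          (from (down-spec (suc (toℕ i)) i) ≤-refl) (from (up-spec r i) r≤1+i))
  ... | no r≰1+i = ≰⇒> r≰1+i

  -- Third, c_t ≤ s₀ ≤ aⱼ for all j, so t ≤ l by the maximality of l.
  admissible⇒t≤l : ∀ t {r} → t ≤ n → Admissible (up r) (down t) → t ≤ l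
  admissible⇒t≤l zero _ _ = z≤n
  admissible⇒t≤l (suc k) t≤n adm with i , refl ← position t≤n =
    proj₁ (proj₂ Lh) i (proj₁ K2 i a₀ (full a₀)) full
    where
    full : ∀ j → T ∋⟨ i , j ⟩
    full j = Admissible.below≤above adm (inj₂ i) (inj₁ j) (from (down-spec (suc (toℕ i)) i) ≤-refl) tt

  admissible⇒staircase : ∀ u v → Admissible u v →
    ∃[ t ] ∃[ r ] (Staircase k₁ (suc l) (t , r) × u ≡ up r × v ≡ down t)
  admissible⇒staircase u v adm
    with r , 1≤r , r≤1+n , refl ← upClosed⇒up u (λ i i′ i≤i′ →
           Admissible.above-upward adm (inj₂ i) (inj₂ i′) (from (chainLe-⇔ i i′) i≤i′))
       | t , t≤n , refl ← downClosed⇒down v (λ i i′ i≤i′ →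
           Admissible.below-downward adm (inj₂ i) (inj₂ i′) (from (chainLe-⇔ i i′) i≤i′))
    = t , r , (s≤s (admissible⇒t≤l t t≤n adm) , admissible⇒t<r t t≤n 1≤r adm , admissible⇒r≤k₁ r≤1+n adm) ,
      refl , refl

  staircase-bounds : ∀ {t r} → Staircase k₁ (suc l) (t , r) → t ≤ n × 1 ≤ r × r ≤ suc n
  staircase-bounds (s≤s t≤l , t<r , r≤k₁) =
    s≤s⁻¹ (≤-trans (s≤s t≤l) (≤-trans l<k₁ k₁≤1+n)) , ≤-trans (s≤s z≤n) t<r , ≤-trans r≤k₁ k₁≤1+n

  fiberElem-injective : ∀ {p p′} → Staircase k₁ (suc l) p → Staircase k₁ (suc l) p′ →
    fiberElem p ≡ fiberElem p′ → p ≡ p′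
  fiberElem-injective {t , r} {t′ , r′} st st′ eq
    with t≤n , 1≤r , r≤1+n ← staircase-bounds st | t′≤n , 1≤r′ , r′≤1+n ← staircase-bounds st′ =
    cong₂ _,_ (down-injective t≤n t′≤n same-column) (up-injective 1≤r r≤1+n 1≤r′ r′≤1+n same-row)
    where
    same-row : up r ≡ up r′
    same-row = cong (λ x → head (proj₁ x)) eq
    same-column : down t ≡ down t′
    same-column = begin
      down t                           ≡⟨ sym (head-addColumn (down t) T) ⟩
      map head (addColumn (down t) T)  ≡⟨ cong (λ x → map head (proj₂ x)) eq ⟩
      map head (addColumn (down t′) T) ≡⟨ head-addColumn (down t′) T ⟩
      down t′                          ∎
      where open ≡-Reasoning

  fiber-shape : ∀ x → η x ≡ (R , T) → x ≡ extended (head (proj₁ x)) (map head (proj₂ x))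
  fiber-shape (u ∷ R′ , T′) eq =
    cong₂ _,_ (cong (u ∷_) (cong proj₁ eq))
              (trans (sym (addColumn-η T′)) (cong (addColumn (map head T′)) (cong proj₂ eq)))

  staircase⇔fiber : ∀ x → (∃[ p ] (Staircase k₁ (suc l) p × fiberElem p ≡ x)) ⇔ InFiber (R , T) x
  staircase⇔fiber x = mk⇔ inFiber fromFiber
    where
    inFiber : ∃[ p ] (Staircase k₁ (suc l) p × fiberElem p ≡ x) → InFiber (R , T) x
    inFiber ((t , r) , st , refl) =
      admissible⇒isSC (up r) (down t) ac (staircase⇒admissible st) ,
      cong (R ,_) (tail-addColumn (down t) T)
    fromFiber : InFiber (R , T) x → ∃[ p ] (Staircase k₁ (suc l) p × fiberElem p ≡ x)
    fromFiber (sc , eq)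
      with t , r , st , u≡up , v≡down ← admissible⇒staircase _ _
             (isSC⇒admissible _ _ (subst IsSC (fiber-shape x eq) sc)) =
      (t , r) , st , sym (trans (fiber-shape x eq) (cong₂ extended u≡up v≡down))

lemma4p5 : (m n : ℕ) → 1 ≤ m → (R : Rel₂ m n) (T : Rel₂ n m) →
    IsAC (R , T) → (k₁ k₂ l : ℕ) → IsK1 R k₁ → IsK2 T k₂ → IsL T k₂ l →
    HasCard (InFiber (R , T)) (k₁ * suc l ∸ (suc l) C 2)
lemma4p5 (suc m) n _ R T ac k₁ k₂ l K1 K2 Lh =
  hasCard-⇔ staircase⇔fiber size
    (hasCard-image fiberElem fiberElem-injective (hasCard-staircase k₁ (suc l)))
  where
  open Fiber F.zero R T ac K1 K2 Lh
  size : stairSize k₁ (suc l) ≡ k₁ * suc l ∸ suc l C 2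
  size = begin
    stairSize k₁ (suc l)                         ≡⟨ sym (m+n∸n≡m _ (suc l C 2)) ⟩
    stairSize k₁ (suc l) + suc l C 2 ∸ suc l C 2 ≡⟨ cong (_∸ suc l C 2) (stairSize-closed k₁ (suc l) l<k₁) ⟩
    k₁ * suc l ∸ suc l C 2                       ∎
    where open ≡-Reasoning
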